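{- Let $\eta\in\mathbb{N}^n$ be a nonzero composition. Then $l[\Phi\eta]=l[\eta]$. Moreover, for $1\le i\le n-1$, $l[s_i\eta]=l[\eta]$ except in the following two cases: (1) if $k[\eta]=i$ and $\eta_{i+1}=\eta_i-1$, then $l[s_i\eta]=l[\eta]+1$; (2) if $k[\eta]=i+1$ and $\eta_i=\eta_{i+1}-1$, then $l[s_i\eta]=l[\eta]-1$.
   Context: For a nonzero composition $\eta\in\mathbb{N}^n$ let $m=\max_i\eta_i$ and $k[\eta]=\min\{i:\eta_i=m\}$ (critical row), and define the critical leg $l[\eta]=\#\{i>k[\eta]:\eta_i=m\}+\#\{i<k[\eta]:\eta_i=m-1\}$. $\Phi\eta=(\eta_2,\dots,\eta_n,\eta_1+1)$; $s_i\eta$ is $\eta$ with entries $\eta_i,\eta_{i+1}$ swapped. -}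

module Defs where

open import Data.Nat using (ℕ; zero; suc; _⊔_; _+_; _∸_)
open import Data.Nat.Properties using (_≟_)
open import Data.Fin using (Fin; zero; suc; inject₁; toℕ; _<_)
open import Data.Fin.Properties using (_<?_)
open import Data.Vec using (Vec; []; _∷_; lookup; foldr; _∷ʳ_; updateAt; _[_]≔_)
open import Data.Product using (∃; _×_)
open import Relation.Binary.PropositionalEquality using (_≡_; _≢_)
open import Relation.Nullary using (yes; no; ¬_)
open import Relation.Nullary.Decidable using (⌊_⌋)
open import Data.Bool using (Bool; true; false; _∧_)

-- A composition with n parts: η = (η₁,…,ηₙ), stored 0-indexed: position p : Fin n
-- corresponds to the paper's index toℕ p + 1.

NonzeroComp : ∀ {n} → Vec ℕ n → Set
NonzeroComp {n} η = ∃ λ (p : Fin n) → lookup η p ≢ 0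

maxPart : ∀ {n} → Vec ℕ n → ℕ
maxPart = foldr _ _⊔_ 0

firstIndexOf : ∀ {n} → ℕ → Vec ℕ (suc n) → Fin (suc n)
firstIndexOf m (x ∷ []) = zero
firstIndexOf m (x ∷ y ∷ xs) with x ≟ m
... | yes _ = zero
... | no _  = suc (firstIndexOf m (y ∷ xs))

crit : ∀ {n} → Vec ℕ (suc n) → Fin (suc n)
crit η = firstIndexOf (maxPart η) η

countFin : ∀ {n} → (Fin n → Bool) → ℕ
countFin {zero}  P = 0
countFin {suc n} P = (if P zero then 1 else 0) + countFin (λ p → P (suc p))
  where
  if_then_else_ : Bool → ℕ → ℕ → ℕ
  if true then a else b = a
  if false then a else b = b

leg : ∀ {n} → Vec ℕ (suc n) → ℕ
leg η =
  countFin (λ p → ⌊ crit η <? p ⌋ ∧ ⌊ lookup η p ≟ maxPart η ⌋)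
  + countFin (λ p → ⌊ p <? crit η ⌋ ∧ ⌊ lookup η p ≟ maxPart η ∸ 1 ⌋)

Φ : ∀ {n} → Vec ℕ (suc n) → Vec ℕ (suc n)
Φ (x ∷ xs) = xs ∷ʳ suc x

-- s_i η : swap entries i and i+1 ; here i ranges over Fin n, i.e. the paper's
-- 1 ≤ i ≤ n-1 for a composition of length suc n, with the paper's entries
-- η_i , η_{i+1} at positions inject₁ i , suc i.
swapAdj : ∀ {n} → Fin n → Vec ℕ (suc n) → Vec ℕ (suc n)
swapAdj i η =
  (η [ inject₁ i ]≔ lookup η (suc i)) [ suc i ]≔ lookup η (inject₁ i)

{-# OPTIONS --safe #-}
-- Measure the leg at an arbitrary level m instead of the maximum: reading the row from the left, it
-- counts the entries equal to m − 1 before the first m and the entries equal to m after it, so it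
-- satisfies a recursion on the first entry. Under Φ, either η₁ + 1 is a new strict maximum, and both
-- legs count the entries of η₂ … ηₙ equal to η₁, or the maximum m is unchanged and η₁ is counted
-- (before the critical row, as m − 1) exactly when η₁ + 1 (now after it) equals m. A swap of
-- adjacent entries changes the leg only when it moves an m − 1 across the first occurrence of m.
module Submission where

open import Defs
open import Algebra.Properties.CommutativeSemigroup as CommutativeSemigroupProperties using ()
open import Data.Bool using (Bool; true; false; _∧_)
open import Data.Empty using (⊥-elim)
open import Data.Fin using (Fin; zero; suc; inject₁)
open import Data.Fin.Properties using (_<?_; 0≢1+n; suc-injective)
open import Data.Nat using (ℕ; zero; suc; _+_; _∸_; _⊔_; _≤_; _<_; s≤s; s≤s⁻¹; z≤n)
open import Data.Nat.Properties
  using ( _≟_; _≤?_; ≤-trans; <⇒≤; <⇒≢; <⇒≱; ≰⇒>; m≤n⇒m≤1+n; 1+n≢n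
        ; +-identityʳ; +-assoc; +-comm; +-suc; +-commutativeSemigroup
        ; ⊔-identityʳ; ⊔-assoc; ⊔-sel; m≤m⊔n; m≤n⊔m; m≤n⇒m⊔n≡n; m≥n⇒m⊔n≡m; ⊔-commutativeSemigroup)
open import Data.Product using (_×_; _,_; proj₁; proj₂)
open import Data.Sum using (inj₁; inj₂)
open import Data.Vec using (Vec; []; _∷_; _∷ʳ_; lookup)
open import Data.Vec.Membership.Propositional using (_∈_; _∉_)
open import Data.Vec.Relation.Unary.Any using (here; there)
open import Function using (_∘_)
open import Relation.Binary.PropositionalEquality
  using (_≡_; _≢_; refl; sym; trans; cong; cong₂; subst; module ≡-Reasoning)
open import Relation.Nullary using (¬_; Dec; yes; no)
open import Relation.Nullary.Decidable using (⌊_⌋)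

module +-CS = CommutativeSemigroupProperties +-commutativeSemigroup
module ⊔-CS = CommutativeSemigroupProperties ⊔-commutativeSemigroup

𝟙 : Bool → ℕ
𝟙 true  = 1
𝟙 false = 0

𝟙[≡] : ∀ {x y} → x ≡ y → 𝟙 ⌊ x ≟ y ⌋ ≡ 1
𝟙[≡] {x} {y} x≡y with x ≟ y
... | yes _   = refl
... | no x≢y  = ⊥-elim (x≢y x≡y)

𝟙[≢] : ∀ {x y} → x ≢ y → 𝟙 ⌊ x ≟ y ⌋ ≡ 0
𝟙[≢] {x} {y} x≢y with x ≟ y
... | yes x≡y = ⊥-elim (x≢y x≡y)
... | no _    = refl

⌊⌋-⇔ : ∀ {P Q : Set} (p? : Dec P) (q? : Dec Q) → (P → Q) → (Q → P) → ⌊ p? ⌋ ≡ ⌊ q? ⌋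
⌊⌋-⇔ (yes _) (yes _) _   _   = refl
⌊⌋-⇔ (yes p) (no ¬q) P→Q _   = ⊥-elim (¬q (P→Q p))
⌊⌋-⇔ (no ¬p) (yes q) _   Q→P = ⊥-elim (¬p (Q→P q))
⌊⌋-⇔ (no _)  (no _)  _   _   = refl

-- Not definitional: Fin's _<?_ compares via toℕ.
⌊suc<?suc⌋ : ∀ {n} (c p : Fin n) → ⌊ suc c <? suc p ⌋ ≡ ⌊ c <? p ⌋
⌊suc<?suc⌋ c p = ⌊⌋-⇔ (suc c <? suc p) (c <? p) s≤s⁻¹ s≤s

≡∸1⇒suc≡ : ∀ {x m} → x ≢ m → x ≡ m ∸ 1 → suc x ≡ m
≡∸1⇒suc≡ {m = zero}  x≢m x≡m∸1 = ⊥-elim (x≢m x≡m∸1)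
≡∸1⇒suc≡ {m = suc _} _   x≡m∸1 = cong suc x≡m∸1

countFin-suc : ∀ {n} (P : Fin (suc n) → Bool) → countFin P ≡ 𝟙 (P zero) + countFin (P ∘ suc)
countFin-suc P with P zero
... | true  = refl
... | false = refl

countFin-cong : ∀ {n} {P Q : Fin n → Bool} → (∀ p → P p ≡ Q p) → countFin P ≡ countFin Q
countFin-cong {zero}          _   = refl
countFin-cong {suc n} {P} {Q} P≗Q = begin
  countFin P                          ≡⟨ countFin-suc P ⟩
  𝟙 (P zero) + countFin (P ∘ suc)     ≡⟨ cong₂ _+_ (cong 𝟙 (P≗Q zero)) (countFin-cong (P≗Q ∘ suc)) ⟩
  𝟙 (Q zero) + countFin (Q ∘ suc)     ≡⟨ countFin-suc Q ⟨
  countFin Q                          ∎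
  where open ≡-Reasoning

countFin-false : ∀ {n} → countFin {n} (λ _ → false) ≡ 0
countFin-false {zero}  = refl
countFin-false {suc n} = countFin-false {n}

occurrences : ∀ {n} → ℕ → Vec ℕ n → ℕ
occurrences m []       = 0
occurrences m (x ∷ xs) = 𝟙 ⌊ x ≟ m ⌋ + occurrences m xs

occurrences-∷ʳ : ∀ {n} m (v : Vec ℕ n) y → occurrences m (v ∷ʳ y) ≡ occurrences m v + 𝟙 ⌊ y ≟ m ⌋
occurrences-∷ʳ m []      y = +-identityʳ (𝟙 ⌊ y ≟ m ⌋)
occurrences-∷ʳ m (x ∷ v) y =
  trans (cong (𝟙 ⌊ x ≟ m ⌋ +_) (occurrences-∷ʳ m v y))
        (sym (+-assoc (𝟙 ⌊ x ≟ m ⌋) (occurrences m v) (𝟙 ⌊ y ≟ m ⌋)))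

occurrences-swapAdj : ∀ {n} m (i : Fin n) (v : Vec ℕ (suc n)) → occurrences m (swapAdj i v) ≡ occurrences m v
occurrences-swapAdj m zero    (x ∷ y ∷ xs) = +-CS.x∙yz≈y∙xz (𝟙 ⌊ y ≟ m ⌋) (𝟙 ⌊ x ≟ m ⌋) (occurrences m xs)
occurrences-swapAdj m (suc i) (x ∷ v)      = cong (𝟙 ⌊ x ≟ m ⌋ +_) (occurrences-swapAdj m i v)

countFin-lookup≡occurrences : ∀ {n} m (v : Vec ℕ n) → countFin (λ p → ⌊ lookup v p ≟ m ⌋) ≡ occurrences m v
countFin-lookup≡occurrences m []       = refl
countFin-lookup≡occurrences m (x ∷ xs) =
  trans (countFin-suc (λ p → ⌊ lookup (x ∷ xs) p ≟ m ⌋))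
        (cong (𝟙 ⌊ x ≟ m ⌋ +_) (countFin-lookup≡occurrences m xs))

legFrom : ∀ {n} → Fin (suc n) → ℕ → Vec ℕ (suc n) → ℕ
legFrom c m v =
  countFin (λ p → ⌊ c <? p ⌋ ∧ ⌊ lookup v p ≟ m ⌋)
  + countFin (λ p → ⌊ p <? c ⌋ ∧ ⌊ lookup v p ≟ m ∸ 1 ⌋)

legFrom-zero : ∀ {n} m x (xs : Vec ℕ n) → legFrom zero m (x ∷ xs) ≡ occurrences m xs
legFrom-zero {n} m x xs =
  trans (cong₂ _+_ (countFin-lookup≡occurrences m xs) (countFin-false {suc n}))
        (+-identityʳ (occurrences m xs))

legFrom-suc : ∀ {n} c m x (ys : Vec ℕ (suc n)) →
  legFrom (suc c) m (x ∷ ys) ≡ 𝟙 ⌊ x ≟ m ∸ 1 ⌋ + legFrom c m ys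
legFrom-suc c m x ys = begin
  countFin (λ p → ⌊ suc c <? p ⌋ ∧ isM p) + countFin (λ p → ⌊ p <? suc c ⌋ ∧ isM∸1 p)
    ≡⟨ cong₂ _+_ (countFin-cong (λ p → cong (_∧ isM (suc p)) (⌊suc<?suc⌋ c p)))
                 (trans (countFin-suc (λ p → ⌊ p <? suc c ⌋ ∧ isM∸1 p))
                        (cong (𝟙 ⌊ x ≟ m ∸ 1 ⌋ +_) (countFin-cong (λ p → cong (_∧ isM∸1 (suc p)) (⌊suc<?suc⌋ p c))))) ⟩
  above + (𝟙 ⌊ x ≟ m ∸ 1 ⌋ + below)
    ≡⟨ +-CS.x∙yz≈y∙xz above (𝟙 ⌊ x ≟ m ∸ 1 ⌋) below ⟩
  𝟙 ⌊ x ≟ m ∸ 1 ⌋ + (above + below) ∎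
  where
  open ≡-Reasoning
  isM isM∸1 : Fin (suc (suc _)) → Bool
  isM   p = ⌊ lookup (x ∷ ys) p ≟ m ⌋
  isM∸1 p = ⌊ lookup (x ∷ ys) p ≟ m ∸ 1 ⌋
  above below : ℕ
  above = countFin (λ p → ⌊ c <? p ⌋ ∧ ⌊ lookup ys p ≟ m ⌋)
  below = countFin (λ p → ⌊ p <? c ⌋ ∧ ⌊ lookup ys p ≟ m ∸ 1 ⌋)

-- leg η is legAt (maxPart η) η by definition. If m does not occur in v, firstIndexOf m v is the
-- last position and legAt m v is junk, hence the hypotheses m ∈ v below.
legAt : ∀ {n} → ℕ → Vec ℕ (suc n) → ℕ
legAt m v = legFrom (firstIndexOf m v) m v

firstIndexOf-≡ : ∀ {n m x} (xs : Vec ℕ n) → x ≡ m → firstIndexOf m (x ∷ xs) ≡ zero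
firstIndexOf-≡         []      _   = refl
firstIndexOf-≡ {m = m} {x} (_ ∷ _) x≡m with x ≟ m
... | yes _   = refl
... | no x≢m  = ⊥-elim (x≢m x≡m)

firstIndexOf-≢ : ∀ {n m x} (ys : Vec ℕ (suc n)) → x ≢ m → firstIndexOf m (x ∷ ys) ≡ suc (firstIndexOf m ys)
firstIndexOf-≢ {m = m} {x} (_ ∷ _) x≢m with x ≟ m
... | yes x≡m = ⊥-elim (x≢m x≡m)
... | no _    = refl

firstIndexOf-suc⁻¹ : ∀ {n m x c} (ys : Vec ℕ (suc n)) →
  firstIndexOf m (x ∷ ys) ≡ suc c → x ≢ m × firstIndexOf m ys ≡ c
firstIndexOf-suc⁻¹ {m = m} {x} ys eq with x ≟ m
... | yes x≡m = ⊥-elim (0≢1+n (trans (sym (firstIndexOf-≡ ys x≡m)) eq))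
... | no x≢m  = x≢m , suc-injective (trans (sym (firstIndexOf-≢ ys x≢m)) eq)

∈-∷⁻ : ∀ {n m x} {xs : Vec ℕ n} → m ∈ x ∷ xs → x ≢ m → m ∈ xs
∈-∷⁻ (here m≡x)   x≢m = ⊥-elim (x≢m (sym m≡x))
∈-∷⁻ (there m∈xs) _   = m∈xs

lookup-firstIndexOf : ∀ {n m} (v : Vec ℕ (suc n)) → m ∈ v → lookup v (firstIndexOf m v) ≡ m
lookup-firstIndexOf (x ∷ [])     (here m≡x) = sym m≡x
lookup-firstIndexOf {m = m} (x ∷ y ∷ ys) m∈v with x ≟ m
... | yes x≡m = x≡m
lookup-firstIndexOf (x ∷ y ∷ ys) (here m≡x)  | no x≢m = ⊥-elim (x≢m (sym m≡x))
lookup-firstIndexOf (x ∷ y ∷ ys) (there m∈ys) | no _   = lookup-firstIndexOf (y ∷ ys) m∈ys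

legAt-∷-≡ : ∀ {n m x} (xs : Vec ℕ n) → x ≡ m → legAt m (x ∷ xs) ≡ occurrences m xs
legAt-∷-≡ {m = m} {x} xs x≡m =
  trans (cong (λ c → legFrom c m (x ∷ xs)) (firstIndexOf-≡ xs x≡m)) (legFrom-zero m x xs)

legAt-∷-≢ : ∀ {n m x} (ys : Vec ℕ (suc n)) → x ≢ m → legAt m (x ∷ ys) ≡ 𝟙 ⌊ x ≟ m ∸ 1 ⌋ + legAt m ys
legAt-∷-≢ {m = m} {x} ys x≢m =
  trans (cong (λ c → legFrom c m (x ∷ ys)) (firstIndexOf-≢ ys x≢m)) (legFrom-suc _ m x ys)

maxPart-∈ : ∀ {n} (v : Vec ℕ (suc n)) → maxPart v ∈ v
maxPart-∈ (x ∷ [])     = here (⊔-identityʳ x)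
maxPart-∈ (x ∷ y ∷ ys) with ⊔-sel x (maxPart (y ∷ ys))
... | inj₁ x⊔M≡x = here x⊔M≡x
... | inj₂ x⊔M≡M = there (subst (_∈ y ∷ ys) (sym x⊔M≡M) (maxPart-∈ (y ∷ ys)))

∈⇒≤maxPart : ∀ {n y} {v : Vec ℕ n} → y ∈ v → y ≤ maxPart v
∈⇒≤maxPart {v = x ∷ xs} (here refl) = m≤m⊔n x (maxPart xs)
∈⇒≤maxPart {v = x ∷ xs} (there y∈xs) = ≤-trans (∈⇒≤maxPart y∈xs) (m≤n⊔m x (maxPart xs))

maxPart-∷ʳ : ∀ {n} (v : Vec ℕ n) y → maxPart (v ∷ʳ y) ≡ maxPart v ⊔ y
maxPart-∷ʳ []      y = ⊔-identityʳ y
maxPart-∷ʳ (x ∷ v) y = trans (cong (x ⊔_) (maxPart-∷ʳ v y)) (sym (⊔-assoc x (maxPart v) y))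

maxPart-swapAdj : ∀ {n} (i : Fin n) (v : Vec ℕ (suc n)) → maxPart (swapAdj i v) ≡ maxPart v
maxPart-swapAdj zero    (x ∷ y ∷ xs) = ⊔-CS.x∙yz≈y∙xz y x (maxPart xs)
maxPart-swapAdj (suc i) (x ∷ v)      = cong (x ⊔_) (maxPart-swapAdj i v)

legAt-∷ʳ : ∀ {n m} (v : Vec ℕ (suc n)) y → m ∈ v → legAt m (v ∷ʳ y) ≡ legAt m v + 𝟙 ⌊ y ≟ m ⌋
legAt-∷ʳ {m = m} (x ∷ xs) y m∈v with x ≟ m
... | yes x≡m = begin
  legAt m (x ∷ (xs ∷ʳ y))             ≡⟨ legAt-∷-≡ (xs ∷ʳ y) x≡m ⟩
  occurrences m (xs ∷ʳ y)             ≡⟨ occurrences-∷ʳ m xs y ⟩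
  occurrences m xs + 𝟙 ⌊ y ≟ m ⌋      ≡⟨ cong (_+ 𝟙 ⌊ y ≟ m ⌋) (legAt-∷-≡ xs x≡m) ⟨
  legAt m (x ∷ xs) + 𝟙 ⌊ y ≟ m ⌋      ∎
  where open ≡-Reasoning
legAt-∷ʳ (x ∷ [])     y m∈v | no x≢m with () ← ∈-∷⁻ m∈v x≢m
legAt-∷ʳ {m = m} (x ∷ x′ ∷ xs) y m∈v | no x≢m = begin
  legAt m (x ∷ ((x′ ∷ xs) ∷ʳ y))                       ≡⟨ legAt-∷-≢ ((x′ ∷ xs) ∷ʳ y) x≢m ⟩
  a + legAt m ((x′ ∷ xs) ∷ʳ y)                         ≡⟨ cong (a +_) (legAt-∷ʳ (x′ ∷ xs) y (∈-∷⁻ m∈v x≢m)) ⟩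
  a + (legAt m (x′ ∷ xs) + 𝟙 ⌊ y ≟ m ⌋)                ≡⟨ +-assoc a _ _ ⟨
  a + legAt m (x′ ∷ xs) + 𝟙 ⌊ y ≟ m ⌋                  ≡⟨ cong (_+ 𝟙 ⌊ y ≟ m ⌋) (legAt-∷-≢ (x′ ∷ xs) x≢m) ⟨
  legAt m (x ∷ x′ ∷ xs) + 𝟙 ⌊ y ≟ m ⌋                  ∎
  where
  open ≡-Reasoning
  a = 𝟙 ⌊ x ≟ m ∸ 1 ⌋

legAt-∷ʳ-∉ : ∀ {n m} (v : Vec ℕ n) → m ∉ v → legAt m (v ∷ʳ m) ≡ occurrences (m ∸ 1) v
legAt-∷ʳ-∉ {m = m} []      _   = legAt-∷-≡ {m = m} [] refl
legAt-∷ʳ-∉ {m = m} (x ∷ v) m∉v =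
  trans (legAt-∷-≢ (v ∷ʳ m) (λ x≡m → m∉v (here (sym x≡m))))
        (cong (𝟙 ⌊ x ≟ m ∸ 1 ⌋ +_) (legAt-∷ʳ-∉ v (m∉v ∘ there)))

leg-Φ : ∀ {n} (η : Vec ℕ (suc n)) → leg (Φ η) ≡ leg η
leg-Φ (x ∷ xs) with maxPart xs ≤? x
... | yes M≤x = begin
  legAt (maxPart (xs ∷ʳ suc x)) (xs ∷ʳ suc x)   ≡⟨ cong (λ m → legAt m (xs ∷ʳ suc x)) max≡1+x ⟩
  legAt (suc x) (xs ∷ʳ suc x)                   ≡⟨ legAt-∷ʳ-∉ xs (λ 1+x∈xs → <⇒≱ (s≤s M≤x) (∈⇒≤maxPart 1+x∈xs)) ⟩
  occurrences x xs                              ≡⟨ legAt-∷-≡ xs refl ⟨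
  legAt x (x ∷ xs)                              ≡⟨ cong (λ m → legAt m (x ∷ xs)) (m≥n⇒m⊔n≡m M≤x) ⟨
  legAt (x ⊔ maxPart xs) (x ∷ xs)               ∎
  where
  open ≡-Reasoning
  max≡1+x : maxPart (xs ∷ʳ suc x) ≡ suc x
  max≡1+x = trans (maxPart-∷ʳ xs (suc x)) (m≤n⇒m⊔n≡n (m≤n⇒m≤1+n M≤x))
leg-Φ (x ∷ [])       | no M≰x = ⊥-elim (M≰x z≤n)
leg-Φ (x ∷ x′ ∷ xs)  | no M≰x = begin
  legAt (maxPart (ys ∷ʳ suc x)) (ys ∷ʳ suc x)   ≡⟨ cong (λ m → legAt m (ys ∷ʳ suc x)) max≡M ⟩
  legAt M (ys ∷ʳ suc x)                         ≡⟨ legAt-∷ʳ ys (suc x) (maxPart-∈ ys) ⟩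
  legAt M ys + 𝟙 ⌊ suc x ≟ M ⌋                  ≡⟨ +-comm (legAt M ys) _ ⟩
  𝟙 ⌊ suc x ≟ M ⌋ + legAt M ys                  ≡⟨ cong (λ b → 𝟙 b + legAt M ys) 1+x≡M⇔x≡M∸1 ⟩
  𝟙 ⌊ x ≟ M ∸ 1 ⌋ + legAt M ys                  ≡⟨ legAt-∷-≢ ys (<⇒≢ x<M) ⟨
  legAt M (x ∷ ys)                              ≡⟨ cong (λ m → legAt m (x ∷ ys)) (m≤n⇒m⊔n≡n (<⇒≤ x<M)) ⟨
  legAt (x ⊔ M) (x ∷ ys)                        ∎
  where
  open ≡-Reasoning
  ys = x′ ∷ xs
  M  = maxPart ys
  x<M : x < M
  x<M = ≰⇒> M≰x
  max≡M : maxPart (ys ∷ʳ suc x) ≡ M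
  max≡M = trans (maxPart-∷ʳ ys (suc x)) (m≥n⇒m⊔n≡m x<M)
  1+x≡M⇔x≡M∸1 : ⌊ suc x ≟ M ⌋ ≡ ⌊ x ≟ M ∸ 1 ⌋
  1+x≡M⇔x≡M∸1 = ⌊⌋-⇔ (suc x ≟ M) (x ≟ M ∸ 1) (cong (_∸ 1)) (≡∸1⇒suc≡ (<⇒≢ x<M))

legAt-swap-head-suc : ∀ {n m x y} (xs : Vec ℕ n) → x ≡ m → suc y ≡ m →
  legAt m (y ∷ x ∷ xs) ≡ suc (legAt m (x ∷ y ∷ xs))
legAt-swap-head-suc {m = m} {x} {y} xs x≡m 1+y≡m = begin
  legAt m (y ∷ x ∷ xs)                    ≡⟨ legAt-∷-≢ (x ∷ xs) y≢m ⟩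
  𝟙 ⌊ y ≟ m ∸ 1 ⌋ + legAt m (x ∷ xs)      ≡⟨ cong₂ _+_ (𝟙[≡] (cong (_∸ 1) 1+y≡m)) (legAt-∷-≡ xs x≡m) ⟩
  suc (occurrences m xs)                  ≡⟨ cong (λ k → suc (k + occurrences m xs)) (𝟙[≢] y≢m) ⟨
  suc (occurrences m (y ∷ xs))            ≡⟨ cong suc (legAt-∷-≡ (y ∷ xs) x≡m) ⟨
  suc (legAt m (x ∷ y ∷ xs))              ∎
  where
  open ≡-Reasoning
  y≢m : y ≢ m
  y≢m y≡m = 1+n≢n (trans 1+y≡m (sym y≡m))

legAt-swap-head-≢ : ∀ {n m x y} (xs : Vec ℕ n) → x ≡ m → y ≢ m → suc y ≢ m →
  legAt m (y ∷ x ∷ xs) ≡ legAt m (x ∷ y ∷ xs)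
legAt-swap-head-≢ {m = m} {x} {y} xs x≡m y≢m 1+y≢m = begin
  legAt m (y ∷ x ∷ xs)                    ≡⟨ legAt-∷-≢ (x ∷ xs) y≢m ⟩
  𝟙 ⌊ y ≟ m ∸ 1 ⌋ + legAt m (x ∷ xs)      ≡⟨ cong₂ _+_ (𝟙[≢] (1+y≢m ∘ ≡∸1⇒suc≡ y≢m)) (legAt-∷-≡ xs x≡m) ⟩
  occurrences m xs                        ≡⟨ cong (_+ occurrences m xs) (𝟙[≢] y≢m) ⟨
  occurrences m (y ∷ xs)                  ≡⟨ legAt-∷-≡ (y ∷ xs) x≡m ⟨
  legAt m (x ∷ y ∷ xs)                    ∎
  where open ≡-Reasoning

legAt-swap-head-≢≢ : ∀ {n m x y} (xs : Vec ℕ n) → m ∈ xs → x ≢ m → y ≢ m →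
  legAt m (y ∷ x ∷ xs) ≡ legAt m (x ∷ y ∷ xs)
legAt-swap-head-≢≢ {m = m} {x} {y} (z ∷ zs) _ x≢m y≢m = begin
  legAt m (y ∷ x ∷ z ∷ zs)                ≡⟨ legAt-∷-≢ (x ∷ z ∷ zs) y≢m ⟩
  b + legAt m (x ∷ z ∷ zs)                ≡⟨ cong (b +_) (legAt-∷-≢ (z ∷ zs) x≢m) ⟩
  b + (a + legAt m (z ∷ zs))              ≡⟨ +-CS.x∙yz≈y∙xz b a (legAt m (z ∷ zs)) ⟩
  a + (b + legAt m (z ∷ zs))              ≡⟨ cong (a +_) (legAt-∷-≢ (z ∷ zs) y≢m) ⟨
  a + legAt m (y ∷ z ∷ zs)                ≡⟨ legAt-∷-≢ (y ∷ z ∷ zs) x≢m ⟨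
  legAt m (x ∷ y ∷ z ∷ zs)                ∎
  where
  open ≡-Reasoning
  a = 𝟙 ⌊ x ≟ m ∸ 1 ⌋
  b = 𝟙 ⌊ y ≟ m ∸ 1 ⌋

legAt-swap-head : ∀ {n m x y} (xs : Vec ℕ n) → m ∈ x ∷ y ∷ xs →
  (x ≡ m → suc y ≢ m) → (y ≡ m → suc x ≢ m) → legAt m (y ∷ x ∷ xs) ≡ legAt m (x ∷ y ∷ xs)
legAt-swap-head {m = m} {x} {y} xs m∈v h₁ h₂ = cases (x ≟ m) (y ≟ m)
  where
  cases : Dec (x ≡ m) → Dec (y ≡ m) → legAt m (y ∷ x ∷ xs) ≡ legAt m (x ∷ y ∷ xs)
  cases (yes x≡m) (yes y≡m) = cong₂ (λ u w → legAt m (u ∷ w ∷ xs)) y≡x (sym y≡x)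
    where y≡x = trans y≡m (sym x≡m)
  cases (yes x≡m) (no y≢m)  = legAt-swap-head-≢ xs x≡m y≢m (h₁ x≡m)
  cases (no x≢m)  (yes y≡m) = sym (legAt-swap-head-≢ xs y≡m x≢m (h₂ y≡m))
  cases (no x≢m)  (no y≢m)  = legAt-swap-head-≢≢ xs (∈-∷⁻ (∈-∷⁻ m∈v x≢m) y≢m) x≢m y≢m

legAt-swapAdj-suc : ∀ {n m} (i : Fin n) (v : Vec ℕ (suc n)) → m ∈ v →
  firstIndexOf m v ≡ inject₁ i → suc (lookup v (suc i)) ≡ lookup v (inject₁ i) →
  legAt m (swapAdj i v) ≡ suc (legAt m v)
legAt-swapAdj-suc zero (x ∷ y ∷ xs) m∈v k≡i 1+y≡x = legAt-swap-head-suc xs x≡m (trans 1+y≡x x≡m)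
  where
  x≡m = trans (cong (lookup (x ∷ y ∷ xs)) (sym k≡i)) (lookup-firstIndexOf (x ∷ y ∷ xs) m∈v)
legAt-swapAdj-suc {m = m} (suc i) (x ∷ w) m∈v k≡i 1+y≡x = begin
  legAt m (x ∷ swapAdj i w)       ≡⟨ legAt-∷-≢ (swapAdj i w) x≢m ⟩
  a + legAt m (swapAdj i w)       ≡⟨ cong (a +_) (legAt-swapAdj-suc i w (∈-∷⁻ m∈v x≢m) k′≡i 1+y≡x) ⟩
  a + suc (legAt m w)             ≡⟨ +-suc a (legAt m w) ⟩
  suc (a + legAt m w)             ≡⟨ cong suc (legAt-∷-≢ w x≢m) ⟨
  suc (legAt m (x ∷ w))           ∎
  where
  open ≡-Reasoning
  x≢m = proj₁ (firstIndexOf-suc⁻¹ w k≡i)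
  k′≡i = proj₂ (firstIndexOf-suc⁻¹ w k≡i)
  a = 𝟙 ⌊ x ≟ m ∸ 1 ⌋

legAt-swapAdj-pred : ∀ {n m} (i : Fin n) (v : Vec ℕ (suc n)) → m ∈ v →
  firstIndexOf m v ≡ suc i → suc (lookup v (inject₁ i)) ≡ lookup v (suc i) →
  legAt m v ≡ suc (legAt m (swapAdj i v))
legAt-swapAdj-pred zero (x ∷ y ∷ xs) m∈v k≡1+i 1+x≡y = legAt-swap-head-suc xs y≡m (trans 1+x≡y y≡m)
  where
  y≡m = trans (cong (lookup (x ∷ y ∷ xs)) (sym k≡1+i)) (lookup-firstIndexOf (x ∷ y ∷ xs) m∈v)
legAt-swapAdj-pred {m = m} (suc i) (x ∷ w) m∈v k≡1+i 1+x≡y = begin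
  legAt m (x ∷ w)                 ≡⟨ legAt-∷-≢ w x≢m ⟩
  a + legAt m w                   ≡⟨ cong (a +_) (legAt-swapAdj-pred i w (∈-∷⁻ m∈v x≢m) k′≡1+i 1+x≡y) ⟩
  a + suc (legAt m (swapAdj i w)) ≡⟨ +-suc a _ ⟩
  suc (a + legAt m (swapAdj i w)) ≡⟨ cong suc (legAt-∷-≢ (swapAdj i w) x≢m) ⟨
  suc (legAt m (x ∷ swapAdj i w)) ∎
  where
  open ≡-Reasoning
  x≢m = proj₁ (firstIndexOf-suc⁻¹ w k≡1+i)
  k′≡1+i = proj₂ (firstIndexOf-suc⁻¹ w k≡1+i)
  a = 𝟙 ⌊ x ≟ m ∸ 1 ⌋

legAt-swapAdj-≡ : ∀ {n m} (i : Fin n) (v : Vec ℕ (suc n)) → m ∈ v →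
  ¬ (firstIndexOf m v ≡ inject₁ i × suc (lookup v (suc i)) ≡ lookup v (inject₁ i)) →
  ¬ (firstIndexOf m v ≡ suc i × suc (lookup v (inject₁ i)) ≡ lookup v (suc i)) →
  legAt m (swapAdj i v) ≡ legAt m v
legAt-swapAdj-≡ zero (x ∷ y ∷ xs) m∈v ¬up ¬down = legAt-swap-head xs m∈v h₁ h₂
  where
  h₁ : _ → suc y ≢ _
  h₁ x≡m 1+y≡m = ¬up (firstIndexOf-≡ (y ∷ xs) x≡m , trans 1+y≡m (sym x≡m))
  h₂ : _ → suc x ≢ _
  h₂ y≡m 1+x≡m = ¬down (trans (firstIndexOf-≢ (y ∷ xs) x≢m) (cong suc (firstIndexOf-≡ xs y≡m)) , trans 1+x≡m (sym y≡m))
    where x≢m = λ x≡m → 1+n≢n (trans 1+x≡m (sym x≡m))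
legAt-swapAdj-≡ {m = m} (suc i) (x ∷ w) m∈v ¬up ¬down = cases (x ≟ m)
  where
  open ≡-Reasoning
  cases : Dec (x ≡ m) → legAt m (x ∷ swapAdj i w) ≡ legAt m (x ∷ w)
  cases (yes x≡m) = begin
    legAt m (x ∷ swapAdj i w)       ≡⟨ legAt-∷-≡ (swapAdj i w) x≡m ⟩
    occurrences m (swapAdj i w)     ≡⟨ occurrences-swapAdj m i w ⟩
    occurrences m w                 ≡⟨ legAt-∷-≡ w x≡m ⟨
    legAt m (x ∷ w)                 ∎
  cases (no x≢m) = begin
    legAt m (x ∷ swapAdj i w)       ≡⟨ legAt-∷-≢ (swapAdj i w) x≢m ⟩
    a + legAt m (swapAdj i w)       ≡⟨ cong (a +_) (legAt-swapAdj-≡ i w (∈-∷⁻ m∈v x≢m) (¬up ∘ shift) (¬down ∘ shift)) ⟩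
    a + legAt m w                   ≡⟨ legAt-∷-≢ w x≢m ⟨
    legAt m (x ∷ w)                 ∎
    where
    a = 𝟙 ⌊ x ≟ m ∸ 1 ⌋
    shift : ∀ {j : Fin _} {P : Set} → firstIndexOf m w ≡ j × P → firstIndexOf m (x ∷ w) ≡ suc j × P
    shift (k′≡j , p) = trans (firstIndexOf-≢ w x≢m) (cong suc k′≡j) , p

leg-swapAdj : ∀ {n} (i : Fin n) (η : Vec ℕ (suc n)) → leg (swapAdj i η) ≡ legAt (maxPart η) (swapAdj i η)
leg-swapAdj i η = cong (λ m → legAt m (swapAdj i η)) (maxPart-swapAdj i η)

lemma4p3 : ∀ {n} (η : Vec ℕ (suc n)) → NonzeroComp η →
    (leg (Φ η) ≡ leg η)
    × (∀ (i : Fin n) →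
        (crit η ≡ inject₁ i → suc (lookup η (suc i)) ≡ lookup η (inject₁ i) →
          leg (swapAdj i η) ≡ suc (leg η))
        × (crit η ≡ suc i → suc (lookup η (inject₁ i)) ≡ lookup η (suc i) →
          leg η ≡ suc (leg (swapAdj i η)))
        × (¬ (crit η ≡ inject₁ i × suc (lookup η (suc i)) ≡ lookup η (inject₁ i)) →
           ¬ (crit η ≡ suc i × suc (lookup η (inject₁ i)) ≡ lookup η (suc i)) →
          leg (swapAdj i η) ≡ leg η))
lemma4p3 η _ = leg-Φ η , λ i →
    (λ k≡i 1+y≡x → trans (leg-swapAdj i η) (legAt-swapAdj-suc i η (maxPart-∈ η) k≡i 1+y≡x))
  , (λ k≡1+i 1+x≡y → trans (legAt-swapAdj-pred i η (maxPart-∈ η) k≡1+i 1+x≡y) (cong suc (sym (leg-swapAdj i η))))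
  , (λ ¬up ¬down → trans (leg-swapAdj i η) (legAt-swapAdj-≡ i η (maxPart-∈ η) ¬up ¬down))
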